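{- Let $n\geq 3$ and let $\pi,\tau\in B_n$ with $\pi=[ABC]$ and $\tau=[BAC]$, where $A,B,C$ are consecutive substrings of the window notation with $|A|,|B|,|C|\geq 1$. Then $d(\pi,\tau)\geq 3$ in $BP_n$.
   Context: Signed permutations of $[\pm n]=\{ -n,\dots,-1,1,\dots,n\}$ are bijections $w$ with $w(-i)=-w(i)$, written in window notation $[w(1)\cdots w(n)]$, with $\underline{i}=-i$; $B_n$ is their group. For $1\leq i\leq n$, $w r_i=[\underline{w(i)}\cdots\underline{w(1)}\,w(i+1)\cdots w(n)]$. The burnt pancake graph $BP_n$ has vertex set $B_n$ and edges $\{w,wr_i\}$ for $w\in B_n$, $1\leq i\leq n$. $d(\pi,\tau)$ is the length of a shortest $\pi$–$\tau$ path in $BP_n$. Window notations are decomposed into consecutive substrings written with capital letters; $|X|$ is the length of substring $X$. -}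

module Defs where

open import Data.Nat using (ℕ; zero; suc; _≤_)
open import Data.Integer using (ℤ; -_; ∣_∣)
open import Data.List using (List; map; reverse; take; drop; _++_; length; applyUpTo)
open import Data.List.Relation.Binary.Permutation.Propositional using (_↭_)
open import Data.Product using (Σ; _×_)
open import Relation.Binary.PropositionalEquality using (_≡_)

-- A signed permutation w ∈ B_n, given by its window [w(1) ⋯ w(n)]:
-- a list of n integers whose absolute values are a permutation of 1,…,n.
SignedPerm : ℕ → List ℤ → Set
SignedPerm n w = length w ≡ n × map ∣_∣ w ↭ applyUpTo suc n

-- w r_i = [ -w(i) ⋯ -w(1) w(i+1) ⋯ w(n) ]
flip : ℕ → List ℤ → List ℤ
flip i w = map -_ (reverse (take i w)) ++ drop i w

Adj : ℕ → List ℤ → List ℤ → Set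
Adj n w v = SignedPerm n w × Σ ℕ (λ i → (1 ≤ i) × (i ≤ n) × (v ≡ flip i w))

data Walk (n : ℕ) : List ℤ → List ℤ → ℕ → Set where
  here : ∀ {w} → Walk n w w 0
  step : ∀ {w u v k} → Adj n w u → Walk n u v k → Walk n w v (suc k)

-- d(π,τ) ≥ m : every π–τ walk (hence every path) in BP_n has length ≥ m
DistGE : ℕ → List ℤ → List ℤ → ℕ → Set
DistGE n π τ m = ∀ k → Walk n π τ k → m ≤ k

module Submission where

-- Idea.  τ = [BAC] arises from π = [ABC] by swapping two adjacent blocks, so
-- τ ≠ π (its first entry differs) and every entry of τ is an entry of π, with
-- the same sign.  In a signed permutation no entry x occurs together with -x.
-- Hence it suffices to show that a walk of length 1 or 2 from a window w
-- either returns to w or produces a window containing -x for an entry x of w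
-- (criterion far-apart).

open import Defs
open import Data.Nat using (ℕ; _≤_)
open import Data.Integer using (ℤ)
open import Data.List using (List; _++_; length)

open import Data.Nat using (zero; suc; _+_; _<_; z≤n; s≤s)
open import Data.Nat.Properties using (<-cmp; <⇒≢; suc-injective)
open import Data.Integer using (-_; ∣_∣; 0ℤ; +_; -[1+_])
open import Data.Integer.Properties using (neg-involutive; ∣-i∣≡∣i∣)
open import Data.List using ([]; _∷_; map; reverse; take; drop; applyUpTo)
open import Data.List.Properties using (map-++; map-∘; map-id; map-cong; length-map; length-reverse; reverse-map; reverse-involutive; ++-assoc; length-++; ∷-injectiveˡ)
open import Data.List.Membership.Propositional using (_∈_)
open import Data.List.Membership.Propositional.Properties using (∈-map⁺; ∈-++⁺ˡ; ∈-++⁺ʳ; ∈-applyUpTo⁻)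
open import Data.List.Relation.Unary.Any using (here; there)
open import Data.List.Relation.Unary.Any.Properties using (reverse⁻; reverse⁺)
open import Data.List.Relation.Unary.All using (lookup)
open import Data.List.Relation.Unary.AllPairs using (_∷_)
open import Data.List.Relation.Unary.Unique.Propositional using (Unique)
open import Data.List.Relation.Unary.Unique.Propositional.Properties using (applyUpTo⁺₁; map⁻)
open import Data.List.Relation.Binary.Subset.Propositional using (_⊆_)
open import Data.List.Relation.Binary.Permutation.Propositional using (_↭_; ↭-sym; ↭-trans; ↭⇒↭ₛ)
open import Data.List.Relation.Binary.Permutation.Propositional.Properties using (∈-resp-↭; ++-comm; ++⁺ʳ) renaming (++-assoc to ++-assoc-↭)
open import Data.List.Relation.Binary.Permutation.Setoid.Properties using (Unique-resp-↭)
open import Data.Product using (_×_; _,_; ∃-syntax)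
open import Data.Sum using (_⊎_; inj₁; inj₂)
open import Data.Empty using (⊥; ⊥-elim)
open import Relation.Binary.Definitions using (tri<; tri≈; tri>)
open import Relation.Binary.PropositionalEquality using (_≡_; _≢_; refl; sym; trans; cong; cong₂; subst; setoid; module ≡-Reasoning)
open import Relation.Nullary using (¬_)

injective-on : {X Y : Set} (f : X → Y) {xs : List X} → Unique (map f xs) →
  ∀ {x y} → x ∈ xs → y ∈ xs → f x ≡ f y → x ≡ y
injective-on f _ (here refl) (here refl) _ = refl
injective-on f (fx∉ ∷ _) (here refl) (there y∈) fx≡fy = ⊥-elim (lookup fx∉ (∈-map⁺ f y∈) fx≡fy)
injective-on f (fy∉ ∷ _) (there x∈) (here refl) fx≡fy = ⊥-elim (lookup fy∉ (∈-map⁺ f x∈) (sym fx≡fy))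
injective-on f (_ ∷ u) (there x∈) (there y∈) fx≡fy = injective-on f u x∈ y∈ fx≡fy

abs-unique : ∀ {n w} → SignedPerm n w → Unique (map ∣_∣ w)
abs-unique {n} (_ , abs↭) = Unique-resp-↭ (setoid ℕ) (↭⇒↭ₛ (↭-sym abs↭))
  (applyUpTo⁺₁ suc n (λ i<j _ si≡sj → <⇒≢ i<j (suc-injective si≡sj)))

entries-unique : ∀ {n w} → SignedPerm n w → Unique w
entries-unique sp = map⁻ (abs-unique sp)

entry-nonzero : ∀ {n w x} → SignedPerm n w → x ∈ w → x ≢ 0ℤ
entry-nonzero (_ , abs↭) x∈ refl with ∈-applyUpTo⁻ suc (∈-resp-↭ abs↭ (∈-map⁺ ∣_∣ x∈))
... | _ , _ , ()

self-negative : ∀ x → - x ≡ x → x ≡ 0ℤ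
self-negative (+ zero) _ = refl
self-negative (+ suc _) ()
self-negative -[1+ _ ] ()

no-opposite-entries : ∀ {n w x} → SignedPerm n w → x ∈ w → - x ∈ w → ⊥
no-opposite-entries {x = x} sp x∈ -x∈ =
  entry-nonzero sp x∈ (self-negative x (injective-on ∣_∣ (abs-unique sp) -x∈ x∈ (∣-i∣≡∣i∣ x)))

≤-length : ∀ {n w i} → SignedPerm n w → i ≤ n → i ≤ length w
≤-length (length≡n , _) i≤n = subst (_ ≤_) (sym length≡n) i≤n

negRev : List ℤ → List ℤ
negRev P = map -_ (reverse P)

length-negRev : ∀ P → length (negRev P) ≡ length P
length-negRev P = trans (length-map -_ (reverse P)) (length-reverse P)

length-negRev-++ : ∀ P S → length (negRev P ++ S) ≡ length (P ++ S)
length-negRev-++ P S = trans (length-++ (negRev P))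
  (trans (cong (λ m → m + length S) (length-negRev P)) (sym (length-++ P)))

negRev-involutive : ∀ P → negRev (negRev P) ≡ P
negRev-involutive P = begin
  map -_ (reverse (map -_ (reverse P)))  ≡⟨ cong (map -_) (sym (reverse-map -_ (reverse P))) ⟩
  map -_ (map -_ (reverse (reverse P)))  ≡⟨ cong (λ Q → map -_ (map -_ Q)) (reverse-involutive P) ⟩
  map -_ (map -_ P)                      ≡⟨ sym (map-∘ P) ⟩
  map (λ x → - - x) P                    ≡⟨ map-cong neg-involutive P ⟩
  map (λ x → x) P                        ≡⟨ map-id P ⟩
  P                                      ∎
  where open ≡-Reasoning

∈-negRev : ∀ {x P} → x ∈ P → - x ∈ negRev P
∈-negRev x∈ = ∈-map⁺ -_ (reverse⁺ x∈)

take-length-++ : ∀ {X : Set} (P D : List X) → take (length P) (P ++ D) ≡ P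
take-length-++ [] D = refl
take-length-++ (x ∷ P) D = cong (x ∷_) (take-length-++ P D)

drop-length-++ : ∀ {X : Set} (P D : List X) → drop (length P) (P ++ D) ≡ D
drop-length-++ [] D = refl
drop-length-++ (x ∷ P) D = drop-length-++ P D

flip-++ : ∀ P D {i} → length P ≡ i → flip i (P ++ D) ≡ negRev P ++ D
flip-++ P D refl = cong₂ (λ Q E → negRev Q ++ E) (take-length-++ P D) (drop-length-++ P D)

split-at : ∀ {X : Set} k (xs : List X) → k ≤ length xs →
  ∃[ P ] ∃[ D ] (xs ≡ P ++ D × length P ≡ k)
split-at zero xs _ = [] , xs , refl , refl
split-at (suc k) (x ∷ xs) (s≤s k≤) with split-at k xs k≤
... | P , D , refl , refl = x ∷ P , D , refl , refl

split-before : ∀ {X : Set} k (xs : List X) → k < length xs →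
  ∃[ P ] ∃[ y ] ∃[ D ] (xs ≡ P ++ y ∷ D × length P ≡ k)
split-before zero (x ∷ xs) _ = [] , x , xs , refl , refl
split-before (suc k) (x ∷ xs) (s≤s k<) with split-before k xs k<
... | P , y , D , refl , refl = x ∷ P , y , D , refl , refl

flip-involutive : ∀ {i} w → i ≤ length w → flip i (flip i w) ≡ w
flip-involutive w i≤ with split-at _ w i≤
... | P , D , refl , refl = begin
  flip (length P) (flip (length P) (P ++ D))  ≡⟨ cong (flip (length P)) (flip-++ P D refl) ⟩
  flip (length P) (negRev P ++ D)             ≡⟨ flip-++ (negRev P) D (length-negRev P) ⟩
  negRev (negRev P) ++ D                      ≡⟨ cong (_++ D) (negRev-involutive P) ⟩
  P ++ D                                      ∎
  where open ≡-Reasoning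

NegatesEntry : List ℤ → List ℤ → Set
NegatesEntry w v = ∃[ x ] (x ∈ w × - x ∈ v)

one-flip-negates : ∀ {i} w → 1 ≤ i → i ≤ length w → NegatesEntry w (flip i w)
one-flip-negates {suc i} (x ∷ w) _ _ = x , here refl , ∈-++⁺ˡ {ys = drop i w} (∈-negRev {P = x ∷ take i w} (here refl))

-- r_i followed by a shorter flip r_j (j < i): the entry of w that r_i moves to
-- position j+1 is negated by r_i and not touched by r_j.
inner-flip-negates : ∀ {i j} w → j < i → i ≤ length w → NegatesEntry w (flip j (flip i w))
inner-flip-negates {i} {j} w j<i i≤ with split-at i w i≤
... | P , D , refl , refl
    with split-before j (reverse P) (subst (j <_) (sym (length-reverse P)) j<i)
... | Q , r , R , revP≡ , refl =
  r , ∈-++⁺ˡ {ys = D} (reverse⁻ (subst (r ∈_) (sym revP≡) (∈-++⁺ʳ Q (here refl)))) ,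
  subst (- r ∈_) (sym flips≡) (∈-++⁺ʳ (negRev (map -_ Q)) (here refl))
  where
    open ≡-Reasoning
    flips≡ : flip (length Q) (flip (length P) (P ++ D)) ≡ negRev (map -_ Q) ++ - r ∷ map -_ R ++ D
    flips≡ = begin
      flip (length Q) (flip (length P) (P ++ D))
        ≡⟨ cong (flip (length Q)) (flip-++ P D refl) ⟩
      flip (length Q) (map -_ (reverse P) ++ D)
        ≡⟨ cong (λ S → flip (length Q) (map -_ S ++ D)) revP≡ ⟩
      flip (length Q) (map -_ (Q ++ r ∷ R) ++ D)
        ≡⟨ cong (λ S → flip (length Q) (S ++ D)) (map-++ -_ Q (r ∷ R)) ⟩
      flip (length Q) ((map -_ Q ++ - r ∷ map -_ R) ++ D)
        ≡⟨ cong (flip (length Q)) (++-assoc (map -_ Q) (- r ∷ map -_ R) D) ⟩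
      flip (length Q) (map -_ Q ++ - r ∷ map -_ R ++ D)
        ≡⟨ flip-++ (map -_ Q) (- r ∷ map -_ R ++ D) (length-map -_ Q) ⟩
      negRev (map -_ Q) ++ - r ∷ map -_ R ++ D
        ∎

-- r_i followed by a longer flip r_j (i < j): the entry at position i+1 is
-- untouched by r_i and negated by r_j.
outer-flip-negates : ∀ {i j} w → i < j → j ≤ length w → NegatesEntry w (flip j (flip i w))
outer-flip-negates {i} {j} w i<j j≤ with split-at j w j≤
... | W , F , refl , refl with split-before i W i<j
... | P , e , E , refl , refl =
  e , ∈-++⁺ˡ {ys = F} (∈-++⁺ʳ P (here refl)) ,
  subst (- e ∈_) (sym flips≡) (∈-++⁺ˡ {ys = F} (∈-negRev (∈-++⁺ʳ (negRev P) (here refl))))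
  where
    open ≡-Reasoning
    j′ = length (P ++ e ∷ E)
    flips≡ : flip j′ (flip (length P) ((P ++ e ∷ E) ++ F)) ≡ negRev (negRev P ++ e ∷ E) ++ F
    flips≡ = begin
      flip j′ (flip (length P) ((P ++ e ∷ E) ++ F))
        ≡⟨ cong (λ S → flip j′ (flip (length P) S)) (++-assoc P (e ∷ E) F) ⟩
      flip j′ (flip (length P) (P ++ e ∷ E ++ F))
        ≡⟨ cong (flip j′) (flip-++ P (e ∷ E ++ F) refl) ⟩
      flip j′ (negRev P ++ e ∷ E ++ F)
        ≡⟨ cong (flip j′) (sym (++-assoc (negRev P) (e ∷ E) F)) ⟩
      flip j′ ((negRev P ++ e ∷ E) ++ F)
        ≡⟨ flip-++ (negRev P ++ e ∷ E) F (length-negRev-++ P (e ∷ E)) ⟩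
      negRev (negRev P ++ e ∷ E) ++ F
        ∎

two-flips : ∀ {i j} w → i ≤ length w → j ≤ length w →
  flip j (flip i w) ≡ w ⊎ NegatesEntry w (flip j (flip i w))
two-flips {i} {j} w i≤ j≤ with <-cmp j i
... | tri< j<i _ _ = inj₂ (inner-flip-negates w j<i i≤)
... | tri≈ _ refl _ = inj₁ (flip-involutive w i≤)
... | tri> _ _ i<j = inj₂ (outer-flip-negates w i<j j≤)

sign-preserving : ∀ {n π τ} → SignedPerm n π → τ ⊆ π → ¬ NegatesEntry π τ
sign-preserving sp τ⊆π (x , x∈ , -x∈) = no-opposite-entries sp x∈ (τ⊆π -x∈)

far-apart : ∀ {n π τ} → SignedPerm n π → τ ≢ π → τ ⊆ π → DistGE n π τ 3
far-apart sp τ≢π τ⊆π 0 here = ⊥-elim (τ≢π refl)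
far-apart {π = π} sp τ≢π τ⊆π 1 (step (_ , i , 1≤i , i≤n , refl) here) =
  ⊥-elim (sign-preserving sp τ⊆π (one-flip-negates π 1≤i (≤-length sp i≤n)))
far-apart {π = π} sp τ≢π τ⊆π 2 (step (_ , i , _ , i≤n , refl) (step (_ , j , _ , j≤n , refl) here))
  with two-flips π (≤-length sp i≤n) (≤-length sp j≤n)
... | inj₁ returns = ⊥-elim (τ≢π returns)
... | inj₂ negates = ⊥-elim (sign-preserving sp τ⊆π negates)
far-apart sp τ≢π τ⊆π (suc (suc (suc _))) _ = s≤s (s≤s (s≤s z≤n))

swap-↭ : (A B C : List ℤ) → B ++ A ++ C ↭ A ++ B ++ C
swap-↭ A B C = ↭-trans (↭-sym (++-assoc-↭ B A C))
  (↭-trans (++⁺ʳ C (++-comm B A)) (++-assoc-↭ A B C))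

-- Swapping two nonempty blocks at the front of a window without repeated
-- entries changes its first entry.
swap-changes-window : {A B C : List ℤ} → Unique (A ++ B ++ C) →
  1 ≤ length A → 1 ≤ length B → B ++ A ++ C ≢ A ++ B ++ C
swap-changes-window {a ∷ A} {b ∷ B} (a∉ ∷ _) _ _ swapped≡ =
  lookup a∉ (∈-++⁺ʳ A (here refl)) (sym (∷-injectiveˡ swapped≡))

lemma4p4 : (n : ℕ) → 3 ≤ n → (A B C π τ : List ℤ) →
    SignedPerm n π → 1 ≤ length A → 1 ≤ length B → 1 ≤ length C →
    π ≡ A ++ B ++ C → τ ≡ B ++ A ++ C →
    DistGE n π τ 3
lemma4p4 n _ A B C π τ sp 1≤|A| 1≤|B| _ refl refl =
  far-apart sp (swap-changes-window {A} {B} {C} (entries-unique sp) 1≤|A| 1≤|B|)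
    (∈-resp-↭ (swap-↭ A B C))
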